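{- Let $D$ be a connected graph and $t\in\mathbb{N}$, $t\ge1$. Then there is a family $\mathcal{F}(D,t)$ of connected subgraphs of $D$ such that each $T\in\mathcal{F}(D,t)$ satisfies $|V(T)|\le 2t$, $\bigcup_{T\in\mathcal{F}(D,t)}V(T)=V(D)$, $|\mathcal{F}(D,t)|\le \frac{|V(D)|}{t}+1$, and $\sum_{T\in\mathcal{F}(D,t)}|V(T)|\le\left(1+\frac1t\right)|V(D)|+1$. -}

module Defs where

open import Data.Nat using (ℕ; suc)
open import Data.Fin using (Fin)
open import Data.Fin.Subset using (Subset; _∈_; ∣_∣)
open import Data.Product using (_×_; ∃)
open import Relation.Nullary using (¬_)

record Graph : Set₁ where
  field
    n      : ℕ
    E      : Fin n → Fin n → Set
    E-sym  : ∀ {u v} → E u v → E v u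
    E-irr  : ∀ {v} → ¬ E v v
open Graph public

data Walk {n : ℕ} (E : Fin n → Fin n → Set) : Fin n → Fin n → Set where
  here : ∀ {v} → Walk E v v
  step : ∀ {u w v} → E u w → Walk E w v → Walk E u v

Connected : Graph → Set
Connected D = Fin (n D) × (∀ u v → Walk (E D) u v)

record Subgraph (D : Graph) : Set₁ where
  field
    V      : Subset (n D)
    SE     : Fin (n D) → Fin (n D) → Set
    SE-sym : ∀ {u v} → SE u v → SE v u
    SE⊆E   : ∀ {u v} → SE u v → E D u v
    SE-end : ∀ {u v} → SE u v → u ∈ V × v ∈ V
open Subgraph public

ConnectedSub : {D : Graph} → Subgraph D → Set
ConnectedSub T = ∃ (λ v → v ∈ V T) × (∀ {u v} → u ∈ V T → v ∈ V T → Walk (SE T) u v)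

size : {D : Graph} → Subgraph D → ℕ
size T = ∣ V T ∣

-- Prune a spanning tree of D leaf by leaf.  Every vertex still in the tree
-- carries a bag: a connected cluster of at most t vertices that hangs from it,
-- initially the vertex alone.  A pruned leaf's bag is merged into its parent's
-- bag; if the merge has more than t vertices it is emitted as a piece (it has
-- at most 2t, being two bags) and the parent's bag restarts as the parent
-- alone.  The root's final bag is the last piece.  Each of the k emitted
-- pieces has more than t vertices and each emission counts only the parent
-- vertex twice, so (t + 1) k + 1 ≤ |V(D)| + k, i.e. t k < |V(D)|, which gives both
-- bounds.

module Submission where

open import Defs
open import Data.Nat using (ℕ; zero; suc; _+_; _*_; _≤_; _<_; _≥_; z≤n; s≤s; _≤?_)
open import Data.Nat.Properties
open import Data.Nat.ListAction using (sum)
open import Data.Nat.Tactic.RingSolver using (solve-∀)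
open import Data.Fin as Fin using (Fin)
open import Data.Fin.Properties using (all?; ¬∀⟶∃¬; injective⇒≤)
open import Data.Fin.Subset as Subset using (Subset; _∈_; ∣_∣; ⁅_⁆; _∪_; inside; outside)
open import Data.Fin.Subset.Properties using (x∈⁅x⁆; x∈⁅y⁆⇒x≡y; x∈p∪q⁺; x∈p∪q⁻; ∉⊥; ∣⊥∣≡0; ∣⁅x⁆∣≡1)
open import Data.List using (List; []; _∷_; [_]; _++_; concat; length; map; lookup)
open import Data.List.Properties using (length-++; length-map; ++-identityʳ)
open import Data.List.Membership.Propositional using () renaming (_∈_ to _∈ₗ_; _∉_ to _∉ₗ_)
open import Data.List.Membership.Propositional.Properties using (∈-++⁺ˡ; ∈-++⁺ʳ; ∈-++⁻; ∈-lookup; ∈-concat⁻; ∈-length)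
open import Data.List.Relation.Binary.Subset.Propositional using (_⊆_)
open import Data.List.Relation.Unary.All as All using (All; []; _∷_; _[_]≔_)
import Data.List.Relation.Unary.All.Properties as All
open import Data.List.Relation.Unary.Any as Any using (Any; here; there)
import Data.List.Relation.Unary.Any.Properties as Any
import Data.Vec as Vec
open import Data.Product using (_×_; Σ; _,_; proj₁; proj₂; ∃; ∃₂)
open import Data.Sum using (_⊎_; inj₁; inj₂)
open import Data.Empty using (⊥-elim)
open import Relation.Nullary using (¬_; yes; no)
open import Relation.Unary using (Pred; Decidable)
open import Relation.Binary.PropositionalEquality using (_≡_; refl; sym; trans; cong; subst; module ≡-Reasoning)

fromList : ∀ {m} → List (Fin m) → Subset m
fromList []       = Subset.⊥
fromList (x ∷ xs) = ⁅ x ⁆ ∪ fromList xs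

∈-fromList⁺ : ∀ {m} {u : Fin m} {xs} → u ∈ₗ xs → u ∈ fromList xs
∈-fromList⁺ {xs = x ∷ _}  (here refl) = x∈p∪q⁺ (inj₁ (x∈⁅x⁆ x))
∈-fromList⁺ {xs = _ ∷ xs} (there u∈)  = x∈p∪q⁺ (inj₂ (∈-fromList⁺ u∈))

∈-fromList⁻ : ∀ {m} {u : Fin m} xs → u ∈ fromList xs → u ∈ₗ xs
∈-fromList⁻ []       u∈ = ⊥-elim (∉⊥ u∈)
∈-fromList⁻ (x ∷ xs) u∈ with x∈p∪q⁻ ⁅ x ⁆ (fromList xs) u∈
... | inj₁ u∈⁅x⁆ = here (x∈⁅y⁆⇒x≡y x u∈⁅x⁆)
... | inj₂ u∈xs  = there (∈-fromList⁻ xs u∈xs)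

∣p∪q∣≤∣p∣+∣q∣ : ∀ {m} (p q : Subset m) → ∣ p ∪ q ∣ ≤ ∣ p ∣ + ∣ q ∣
∣p∪q∣≤∣p∣+∣q∣ Vec.[]             Vec.[]             = z≤n
∣p∪q∣≤∣p∣+∣q∣ (inside  Vec.∷ p) (inside  Vec.∷ q) = s≤s (≤-trans (∣p∪q∣≤∣p∣+∣q∣ p q) (+-monoʳ-≤ ∣ p ∣ (n≤1+n _)))
∣p∪q∣≤∣p∣+∣q∣ (inside  Vec.∷ p) (outside Vec.∷ q) = s≤s (∣p∪q∣≤∣p∣+∣q∣ p q)
∣p∪q∣≤∣p∣+∣q∣ (outside Vec.∷ p) (inside  Vec.∷ q) = ≤-trans (s≤s (∣p∪q∣≤∣p∣+∣q∣ p q)) (≤-reflexive (sym (+-suc _ _)))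
∣p∪q∣≤∣p∣+∣q∣ (outside Vec.∷ p) (outside Vec.∷ q) = ∣p∪q∣≤∣p∣+∣q∣ p q

∣fromList∣≤length : ∀ {m} (xs : List (Fin m)) → ∣ fromList xs ∣ ≤ length xs
∣fromList∣≤length {m} []     = ≤-reflexive (∣⊥∣≡0 m)
∣fromList∣≤length (x ∷ xs) = begin
  ∣ ⁅ x ⁆ ∪ fromList xs ∣        ≤⟨ ∣p∪q∣≤∣p∣+∣q∣ ⁅ x ⁆ (fromList xs) ⟩
  ∣ ⁅ x ⁆ ∣ + ∣ fromList xs ∣    ≡⟨ cong (_+ ∣ fromList xs ∣) (∣⁅x⁆∣≡1 x) ⟩
  suc ∣ fromList xs ∣            ≤⟨ s≤s (∣fromList∣≤length xs) ⟩
  suc (length xs)                ∎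
  where open ≤-Reasoning

module _ {m : ℕ} where

  mapWalk : ∀ {R Q : Fin m → Fin m → Set} {u v} →
            (∀ {x y} → R x y → Q x y) → Walk R u v → Walk Q u v
  mapWalk f here       = here
  mapWalk f (step e w) = step (f e) (mapWalk f w)

  _◅◅_ : ∀ {R : Fin m → Fin m → Set} {u w v} → Walk R u w → Walk R w v → Walk R u v
  here       ◅◅ w′ = w′
  (step e w) ◅◅ w′ = step e (w ◅◅ w′)

  reverseWalk : ∀ {R : Fin m → Fin m → Set} {u v} →
                (∀ {x y} → R x y → R y x) → Walk R u v → Walk R v u
  reverseWalk R-sym here       = here
  reverseWalk R-sym (step e w) = reverseWalk R-sym w ◅◅ step (R-sym e) here

  boundary-edge : ∀ {p} {P : Pred (Fin m) p} {R : Fin m → Fin m → Set} {u w} →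
                  Decidable P → ¬ P u → P w → Walk R u w →
                  ∃₂ λ x y → ¬ P x × P y × R x y
  boundary-edge P? ¬Pu Pw here = ⊥-elim (¬Pu Pw)
  boundary-edge P? ¬Pu Pw (step {w = y} e w) with P? y
  ... | yes Py  = _ , y , ¬Pu , Py , e
  ... | no  ¬Py = boundary-edge P? ¬Py Pw w

module _ {A B : Set} {P : A → Set} (members : ∀ {x} → P x → List B) where

  flatten : ∀ {xs} → All P xs → List B
  flatten []         = []
  flatten (px ∷ pxs) = members px ++ flatten pxs

  length-flatten-≔ : ∀ {x xs} (pxs : All P xs) (i : x ∈ₗ xs) (px : P x) →
    length (flatten (pxs [ i ]≔ px)) + length (members (All.lookup pxs i))
      ≡ length (flatten pxs) + length (members px)
  length-flatten-≔ (py ∷ pxs) (here refl) px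
    rewrite length-++ (members px) {flatten pxs} | length-++ (members py) {flatten pxs}
    = swap (length (members px)) (length (flatten pxs)) (length (members py))
    where
    swap : ∀ a f b → (a + f) + b ≡ (b + f) + a
    swap = solve-∀
  length-flatten-≔ (py ∷ pxs) (there i) px
    rewrite length-++ (members py) {flatten (pxs [ i ]≔ px)} | length-++ (members py) {flatten pxs}
    = prefix (length (members py)) (length-flatten-≔ pxs i px)
    where
    prefix : ∀ a {f′ o f n} → f′ + o ≡ f + n → (a + f′) + o ≡ (a + f) + n
    prefix a eq = trans (+-assoc a _ _) (trans (cong (a +_) eq) (sym (+-assoc a _ _)))

  ∈-flatten-≔⁺ : ∀ {x xs u} (pxs : All P xs) (i : x ∈ₗ xs) (px : P x) →
                 u ∈ₗ members px → u ∈ₗ flatten (pxs [ i ]≔ px)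
  ∈-flatten-≔⁺ (py ∷ pxs) (here refl) px u∈ = ∈-++⁺ˡ u∈
  ∈-flatten-≔⁺ (py ∷ pxs) (there i)   px u∈ = ∈-++⁺ʳ (members py) (∈-flatten-≔⁺ pxs i px u∈)

  ∈-flatten-≔⁻ : ∀ {x xs u} (pxs : All P xs) (i : x ∈ₗ xs) (px : P x) → u ∈ₗ flatten pxs →
                 u ∈ₗ flatten (pxs [ i ]≔ px) ⊎ u ∈ₗ members (All.lookup pxs i)
  ∈-flatten-≔⁻ (py ∷ pxs) (here refl) px u∈ with ∈-++⁻ (members py) u∈
  ... | inj₁ u∈py   = inj₂ u∈py
  ... | inj₂ u∈rest = inj₁ (∈-++⁺ʳ (members px) u∈rest)
  ∈-flatten-≔⁻ (py ∷ pxs) (there i) px u∈ with ∈-++⁻ (members py) u∈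
  ... | inj₁ u∈py   = inj₁ (∈-++⁺ˡ u∈py)
  ... | inj₂ u∈rest with ∈-flatten-≔⁻ pxs i px u∈rest
  ...   | inj₁ u∈new = inj₁ (∈-++⁺ʳ (members py) u∈new)
  ...   | inj₂ u∈old = inj₂ u∈old

m*length≤length-concat : ∀ {A : Set} {m} (xss : List (List A)) →
                         All (λ xs → m ≤ length xs) xss → m * length xss ≤ length (concat xss)
m*length≤length-concat {m = m} []         []           = ≤-reflexive (*-zeroʳ m)
m*length≤length-concat {m = m} (xs ∷ xss) (m≤xs ∷ m≤xss) = begin
  m * suc (length xss)               ≡⟨ *-suc m (length xss) ⟩
  m + m * length xss                 ≤⟨ +-mono-≤ m≤xs (m*length≤length-concat xss m≤xss) ⟩
  length xs + length (concat xss)    ≡⟨ length-++ xs ⟨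
  length (xs ++ concat xss)          ∎
  where open ≤-Reasoning

-- a is the size of the last piece, e the total size and k the number of the
-- heavy pieces, m the number of vertices.
partition-bounds : ∀ t {a e k m} → 1 ≤ a → a + e ≤ m + k → suc t * k ≤ e →
                   t * suc k ≤ m + t × t * (a + e) ≤ (t + 1) * m + t
partition-bounds t {a} {e} {k} {m} 1≤a a+e≤m+k heavy = count-bound , size-bound
  where
  open ≤-Reasoning

  reorder : ∀ t k → suc (t * k) + k ≡ suc t * k + 1
  reorder = solve-∀

  factor : ∀ t m → t * m + m ≡ (t + 1) * m
  factor = solve-∀

  tk<m : t * k < m
  tk<m = +-cancelʳ-≤ k _ m (begin
    suc (t * k) + k  ≡⟨ reorder t k ⟩
    suc t * k + 1    ≤⟨ +-mono-≤ heavy 1≤a ⟩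
    e + a            ≡⟨ +-comm e a ⟩
    a + e            ≤⟨ a+e≤m+k ⟩
    m + k            ∎)

  count-bound : t * suc k ≤ m + t
  count-bound = begin
    t * suc k   ≡⟨ *-suc t k ⟩
    t + t * k   ≤⟨ +-monoʳ-≤ t (<⇒≤ tk<m) ⟩
    t + m       ≡⟨ +-comm t m ⟩
    m + t       ∎

  size-bound : t * (a + e) ≤ (t + 1) * m + t
  size-bound = begin
    t * (a + e)        ≤⟨ *-monoʳ-≤ t a+e≤m+k ⟩
    t * (m + k)        ≡⟨ *-distribˡ-+ t m k ⟩
    t * m + t * k      ≤⟨ +-monoʳ-≤ (t * m) (<⇒≤ tk<m) ⟩
    t * m + m          ≡⟨ factor t m ⟩
    (t + 1) * m        ≤⟨ m≤m+n ((t + 1) * m) t ⟩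
    (t + 1) * m + t    ∎

module Clusters (D : Graph) where

  Vertex : Set
  Vertex = Fin (n D)

  Inside : List Vertex → Vertex → Vertex → Set
  Inside a x y = E D x y × x ∈ₗ a × y ∈ₗ a

  Inside-mono : ∀ {a b} → a ⊆ b → ∀ {x y} → Inside a x y → Inside b x y
  Inside-mono a⊆b (e , x∈ , y∈) = e , a⊆b x∈ , a⊆b y∈

  record Rooted (a : List Vertex) (k : Vertex) : Set where
    constructor rooted
    field
      root∈  : k ∈ₗ a
      toRoot : ∀ {u} → u ∈ₗ a → Walk (Inside a) u k
  open Rooted public

  rooted-[_] : ∀ k → Rooted [ k ] k
  rooted-[ k ] = rooted (here refl) λ { (here refl) → here }

  rooted-++ : ∀ {a b p v} → Rooted a p → Rooted b v → E D v p → Rooted (a ++ b) p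
  rooted-++ {a} {b} ra rb e = rooted (∈-++⁺ˡ (root∈ ra)) walk
    where
    walk : ∀ {u} → u ∈ₗ a ++ b → Walk (Inside (a ++ b)) u _
    walk u∈ with ∈-++⁻ a u∈
    ... | inj₁ u∈a = mapWalk (Inside-mono ∈-++⁺ˡ) (toRoot ra u∈a)
    ... | inj₂ u∈b = mapWalk (Inside-mono (∈-++⁺ʳ a)) (toRoot rb u∈b)
                     ◅◅ step (e , ∈-++⁺ʳ a (root∈ rb) , ∈-++⁺ˡ (root∈ ra)) here

  induced : List Vertex → Subgraph D
  induced a = record
    { V      = fromList a
    ; SE     = λ x y → E D x y × x ∈ fromList a × y ∈ fromList a
    ; SE-sym = λ { (e , x∈ , y∈) → E-sym D e , y∈ , x∈ }
    ; SE⊆E   = proj₁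
    ; SE-end = proj₂
    }

  induced-connected : ∀ {a k} → Rooted a k → ConnectedSub (induced a)
  induced-connected {a} {k} r =
    (k , ∈-fromList⁺ (root∈ r)) ,
    λ u∈ v∈ → toRoot′ u∈ ◅◅ reverseWalk (SE-sym (induced a)) (toRoot′ v∈)
    where
    toRoot′ : ∀ {u} → u ∈ fromList a → Walk (SE (induced a)) u k
    toRoot′ u∈ = mapWalk (λ { (e , x∈ , y∈) → e , ∈-fromList⁺ x∈ , ∈-fromList⁺ y∈ })
                         (toRoot r (∈-fromList⁻ a u∈))

  sum-size-induced≤length-concat : ∀ F → sum (map size (map induced F)) ≤ length (concat F)
  sum-size-induced≤length-concat []      = z≤n
  sum-size-induced≤length-concat (a ∷ F) = begin
    size (induced a) + sum (map size (map induced F))  ≤⟨ +-mono-≤ (∣fromList∣≤length a) (sum-size-induced≤length-concat F) ⟩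
    length a + length (concat F)                       ≡⟨ length-++ a ⟨
    length (a ++ concat F)                             ∎
    where open ≤-Reasoning

module SpanningOrders (D : Graph) where
  open Clusters D using (Vertex)

  -- ks lists the vertices of a tree, every vertex but the last one followed
  -- somewhere by its parent p, so the head of the list is always a leaf.
  data TreeOrder : List Vertex → Set where
    root : ∀ r → TreeOrder [ r ]
    leaf : ∀ {ks v p} → v ∉ₗ ks → p ∈ₗ ks → E D v p → TreeOrder ks → TreeOrder (v ∷ ks)

  TreeOrder-nonempty : ∀ {ks} → TreeOrder ks → ∃ (_∈ₗ ks)
  TreeOrder-nonempty (root r)              = r , here refl
  TreeOrder-nonempty (leaf {v = v} _ _ _ _) = v , here refl

  TreeOrder-lookup-injective : ∀ {ks} → TreeOrder ks → ∀ i j → lookup ks i ≡ lookup ks j → i ≡ j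
  TreeOrder-lookup-injective (root r)           Fin.zero    Fin.zero    _  = refl
  TreeOrder-lookup-injective (leaf _ _ _ _)     Fin.zero    Fin.zero    _  = refl
  TreeOrder-lookup-injective (leaf v∉ _ _ _)    Fin.zero    (Fin.suc j) eq = ⊥-elim (v∉ (subst (_∈ₗ _) (sym eq) (∈-lookup j)))
  TreeOrder-lookup-injective (leaf v∉ _ _ _)    (Fin.suc i) Fin.zero    eq = ⊥-elim (v∉ (subst (_∈ₗ _) eq (∈-lookup i)))
  TreeOrder-lookup-injective (leaf _ _ _ order) (Fin.suc i) (Fin.suc j) eq = cong Fin.suc (TreeOrder-lookup-injective order i j eq)

  TreeOrder-length≤ : ∀ {ks} → TreeOrder ks → length ks ≤ n D
  TreeOrder-length≤ order = injective⇒≤ (λ {i} {j} → TreeOrder-lookup-injective order i j)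

  open import Data.List.Membership.DecPropositional (Fin._≟_ {n D}) using (_∈?_)

  extend : (∀ x y → Walk (E D) x y) → ∀ {ks u} → TreeOrder ks → u ∉ₗ ks → ∃ λ v → TreeOrder (v ∷ ks)
  extend walk {ks} {u} order u∉ with TreeOrder-nonempty order
  ... | w , w∈ with boundary-edge (_∈? ks) u∉ w∈ (walk u w)
  ... | v , p , v∉ , p∈ , e = v , leaf v∉ p∈ e order

  SpanningOrder : Set
  SpanningOrder = ∃ λ ks → TreeOrder ks × (∀ u → u ∈ₗ ks)

  grow : (∀ x y → Walk (E D) x y) → ∀ fuel {ks} → TreeOrder ks → n D ≤ fuel + length ks → SpanningOrder
  grow walk fuel {ks} order bound with all? (_∈? ks)
  ... | yes spans = ks , order , spans
  ... | no ¬spans with ¬∀⟶∃¬ (n D) (_∈ₗ ks) (_∈? ks) ¬spans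
  ... | u , u∉ with fuel | extend walk order u∉
  ...   | zero     | _ , order′ = ⊥-elim (<⇒≱ (TreeOrder-length≤ order′) bound)
  ...   | suc fuel | _ , order′ = grow walk fuel order′ (≤-trans bound (≤-reflexive (sym (+-suc fuel _))))

  spanningOrder : Connected D → SpanningOrder
  spanningOrder (r , walk) = grow walk (n D) (root r) (m≤m+n (n D) 1)

module Partition (D : Graph) (t : ℕ) (t≥1 : t ≥ 1) where
  open Clusters D
  open SpanningOrders D

  Bag : Vertex → Set
  Bag k = Σ (List Vertex) λ a → Rooted a k × length a ≤ t

  Piece : List Vertex → Set
  Piece a = ∃ (Rooted a) × length a ≤ 2 * t

  Heavy : List Vertex → Set
  Heavy a = t < length a

  contents : ∀ {ks} → All Bag ks → List Vertex
  contents = flatten proj₁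

  singletons : ∀ ks → All Bag ks
  singletons []       = []
  singletons (k ∷ ks) = ([ k ] , rooted-[ k ] , t≥1) ∷ singletons ks

  contents-singletons : ∀ ks → contents (singletons ks) ≡ ks
  contents-singletons []       = refl
  contents-singletons (k ∷ ks) = cong (k ∷_) (contents-singletons ks)

  Covers : ∀ {ks} → All Bag ks → List (List Vertex) → Set
  Covers bags done = ∀ u → u ∈ₗ contents bags ++ concat done

  -- Emitting a piece keeps its attachment vertex in a fresh bag, so every
  -- emitted piece counts exactly one vertex twice.
  Balanced : ℕ → ∀ {ks} → All Bag ks → List (List Vertex) → Set
  Balanced N₀ bags done = length (contents bags) + length (concat done) ≡ N₀ + length done

  record State (N₀ : ℕ) (ks : List Vertex) : Set where
    constructor state
    field
      bags     : All Bag ks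
      done     : List (List Vertex)
      pieces   : All Piece done
      heavy    : All Heavy done
      covers   : Covers bags done
      balanced : Balanced N₀ bags done

  initial : ∀ {ks} → (∀ u → u ∈ₗ ks) → State (length ks) ks
  initial {ks} spans = state (singletons ks) [] [] [] covers balanced
    where
    covers : Covers (singletons ks) []
    covers u rewrite contents-singletons ks | ++-identityʳ ks = spans u
    balanced : Balanced (length ks) (singletons ks) []
    balanced = cong (λ xs → length xs + 0) (contents-singletons ks)

  module Reassign {ks v p} (p∈ : p ∈ₗ ks) (e : E D v p) (bv : Bag v) (bags : All Bag ks) where

    old new merged : List Vertex
    old    = proj₁ (All.lookup bags p∈)
    new    = proj₁ bv
    merged = old ++ new

    rooted-merged : Rooted merged p
    rooted-merged = rooted-++ (proj₁ (proj₂ (All.lookup bags p∈))) (proj₁ (proj₂ bv)) e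

    merged≤2t : length merged ≤ 2 * t
    merged≤2t = begin
      length (old ++ new)        ≡⟨ length-++ old ⟩
      length old + length new    ≤⟨ +-mono-≤ (proj₂ (proj₂ (All.lookup bags p∈))) (proj₂ (proj₂ bv)) ⟩
      t + t                      ≡⟨ cong (t +_) (+-identityʳ t) ⟨
      2 * t                      ∎
      where open ≤-Reasoning

    moved-∈ : ∀ (y : Bag p) {u} → u ∈ₗ contents (bv ∷ bags) →
              u ∈ₗ contents (bags [ p∈ ]≔ y) ⊎ u ∈ₗ merged
    moved-∈ y u∈ with ∈-++⁻ new u∈
    ... | inj₁ u∈new  = inj₂ (∈-++⁺ʳ old u∈new)
    ... | inj₂ u∈bags with ∈-flatten-≔⁻ proj₁ bags p∈ y u∈bags
    ...   | inj₁ u∈bags′ = inj₁ u∈bags′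
    ...   | inj₂ u∈old   = inj₂ (∈-++⁺ˡ u∈old)

    moved-length : ∀ (y : Bag p) →
      length (contents (bags [ p∈ ]≔ y)) + length merged
        ≡ length (contents (bv ∷ bags)) + length (proj₁ y)
    moved-length y = begin
      L′ + length (old ++ new)                     ≡⟨ cong (L′ +_) (length-++ old) ⟩
      L′ + (length old + length new)               ≡⟨ +-assoc L′ _ _ ⟨
      (L′ + length old) + length new               ≡⟨ cong (_+ length new) (length-flatten-≔ proj₁ bags p∈ y) ⟩
      (L + length (proj₁ y)) + length new          ≡⟨ rearrange L (length (proj₁ y)) (length new) ⟩
      (length new + L) + length (proj₁ y)          ≡⟨ cong (_+ length (proj₁ y)) (length-++ new) ⟨
      length (new ++ contents bags) + length (proj₁ y)  ∎
      where
      open ≡-Reasoning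
      L L′ : ℕ
      L  = length (contents bags)
      L′ = length (contents (bags [ p∈ ]≔ y))
      rearrange : ∀ a b c → (a + b) + c ≡ (c + a) + b
      rearrange = solve-∀

    covers-after : ∀ y done done′ →
                   merged ⊆ contents (bags [ p∈ ]≔ y) ++ concat done′ →
                   concat done ⊆ concat done′ →
                   Covers (bv ∷ bags) done → Covers (bags [ p∈ ]≔ y) done′
    covers-after y done done′ merged⊆ done⊆ covers u
      with ∈-++⁻ (contents (bv ∷ bags)) (covers u)
    ... | inj₂ u∈done = ∈-++⁺ʳ _ (done⊆ u∈done)
    ... | inj₁ u∈bags with moved-∈ y u∈bags
    ...   | inj₁ u∈bags′  = ∈-++⁺ˡ u∈bags′
    ...   | inj₂ u∈merged = merged⊆ u∈merged

    absorb : ∀ {N₀ done} → length merged ≤ t → All Piece done → All Heavy done →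
             Covers (bv ∷ bags) done → Balanced N₀ (bv ∷ bags) done → State N₀ ks
    absorb {done = done} small pieces heavy covers balanced =
      state (bags [ p∈ ]≔ y) done pieces heavy
            (covers-after y done done (λ u∈ → ∈-++⁺ˡ (∈-flatten-≔⁺ proj₁ bags p∈ y u∈)) (λ u∈ → u∈) covers)
            (trans (cong (_+ length (concat done)) (+-cancelʳ-≡ _ _ _ (moved-length y))) balanced)
      where
      y : Bag p
      y = merged , rooted-merged , small

    emit : ∀ {N₀ done} → t < length merged → All Piece done → All Heavy done →
           Covers (bv ∷ bags) done → Balanced N₀ (bv ∷ bags) done → State N₀ ks
    emit {N₀} {done} large pieces heavy covers balanced =
      state (bags [ p∈ ]≔ y) (merged ∷ done)
            (((p , rooted-merged) , merged≤2t) ∷ pieces) (large ∷ heavy)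
            (covers-after y done (merged ∷ done)
                          (λ u∈ → ∈-++⁺ʳ (contents (bags [ p∈ ]≔ y)) (∈-++⁺ˡ u∈)) (∈-++⁺ʳ merged) covers)
            balanced′
      where
      y : Bag p
      y = [ p ] , rooted-[ p ] , t≥1
      L L′ Dn : ℕ
      L  = length (contents (bv ∷ bags))
      L′ = length (contents (bags [ p∈ ]≔ y))
      Dn = length (concat done)
      balanced′ : Balanced N₀ (bags [ p∈ ]≔ y) (merged ∷ done)
      balanced′ = begin
        L′ + length (merged ++ concat done)  ≡⟨ cong (L′ +_) (length-++ merged) ⟩
        L′ + (length merged + Dn)           ≡⟨ +-assoc L′ _ _ ⟨
        (L′ + length merged) + Dn           ≡⟨ cong (_+ Dn) (trans (moved-length y) (+-comm L 1)) ⟩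
        suc (L + Dn)                        ≡⟨ cong suc balanced ⟩
        suc (N₀ + length done)              ≡⟨ +-suc N₀ (length done) ⟨
        N₀ + suc (length done)              ∎
        where open ≡-Reasoning

    reassign : ∀ {N₀ done} → All Piece done → All Heavy done →
               Covers (bv ∷ bags) done → Balanced N₀ (bv ∷ bags) done → State N₀ ks
    reassign with length merged ≤? t
    ... | yes small = absorb small
    ... | no  large = emit (≰⇒> large)

  pruneLeaf : ∀ {N₀ ks v p} → p ∈ₗ ks → E D v p → State N₀ (v ∷ ks) → State N₀ ks
  pruneLeaf p∈ e (state (bv ∷ bags) _ pieces heavy covers balanced) = reassign pieces heavy covers balanced
    where open Reassign p∈ e bv bags

  run : ∀ {N₀ ks} → TreeOrder ks → State N₀ ks → ∃ λ r → State N₀ [ r ]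
  run (root r)            s = r , s
  run (leaf _ p∈ e order) s = run order (pruneLeaf p∈ e s)

  piece-component : ∀ {a} → Piece a → ConnectedSub (induced a) × size (induced a) ≤ 2 * t
  piece-component {a} ((_ , r) , a≤2t) = induced-connected r , ≤-trans (∣fromList∣≤length a) a≤2t

  Cover : Set
  Cover = Σ (List (List Vertex)) λ F →
    All Piece F × (∀ u → u ∈ₗ concat F) ×
    t * length F ≤ n D + t × t * length (concat F) ≤ (t + 1) * n D + t

  finish : ∀ {N₀ r} → N₀ ≤ n D → State N₀ [ r ] → Cover
  finish {N₀} N₀≤n (state ((a , ra , a≤t) ∷ []) done pieces heavy covers balanced) =
    a ∷ done , ((_ , ra) , ≤-trans a≤t (m≤m+n t (t + 0))) ∷ pieces , covers′ ,
    proj₁ bounds , subst (λ x → t * x ≤ (t + 1) * n D + t) (sym (length-++ a)) (proj₂ bounds)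
    where
    covers′ : ∀ u → u ∈ₗ a ++ concat done
    covers′ u = subst (λ xs → u ∈ₗ xs ++ concat done) (++-identityʳ a) (covers u)

    total : length a + length (concat done) ≤ n D + length done
    total = begin
      length a + length (concat done)         ≡⟨ cong (λ xs → length xs + length (concat done)) (++-identityʳ a) ⟨
      length (a ++ []) + length (concat done) ≡⟨ balanced ⟩
      N₀ + length done                        ≤⟨ +-monoˡ-≤ (length done) N₀≤n ⟩
      n D + length done                       ∎
      where open ≤-Reasoning

    bounds : t * suc (length done) ≤ n D + t × t * (length a + length (concat done)) ≤ (t + 1) * n D + t
    bounds = partition-bounds t (∈-length (root∈ ra)) total (m*length≤length-concat done heavy)

  cover : Connected D → Cover
  cover connected with spanningOrder connected
  ... | ks , order , spans with run order (initial spans)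
  ... | _ , final = finish (TreeOrder-length≤ order) final

proposition14 : (D : Graph) → Connected D → (t : ℕ) → t ≥ 1 →
    Σ (List (Subgraph D)) (λ F →
      All (λ T → ConnectedSub T × size T ≤ 2 * t) F
      × (∀ (v : Fin (n D)) → Any (λ T → v ∈ V T) F)
      × t * length F ≤ n D + t
      × t * sum (map size F) ≤ (t + 1) * n D + t)
proposition14 D connected t t≥1 with Partition.cover D t t≥1 connected
... | F , pieces , covers , count , total =
  map induced F ,
  All.map⁺ (All.map (Partition.piece-component D t t≥1) pieces) ,
  (λ u → Any.map⁺ (Any.map ∈-fromList⁺ (∈-concat⁻ F (covers u)))) ,
  subst (λ l → t * l ≤ n D + t) (sym (length-map induced F)) count ,
  ≤-trans (*-monoʳ-≤ t (sum-size-induced≤length-concat F)) total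
  where open Clusters D
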